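{- Let $G$ be a $2$-edge-connected graph and let $C$ be a non-separating cycle of $G$ such that the contracted graph $G/E(C)$ admits a nowhere-zero $4$-flow. Then $G$ has a $5$-CDC $\mathcal S$ with $C \in \mathcal S$.
   Context: Graphs are finite and may have parallel edges and loops. A cycle is a graph (here a subgraph of $G$) in which every vertex has even degree; a circuit is a $2$-regular connected graph. A subgraph $C$ of a connected graph $H$ is non-separating if $H - E(C)$ is connected. A cycle double cover (CDC) of $G$ is a set of cycles of $G$ such that every edge of $G$ lies in the edge sets of exactly two of them; a $k$-CDC is a CDC consisting of $k$ cycles. $G/E(C)$ denotes the graph obtained from $G$ by contracting all edges of $C$. -}

module Defs where

open import Data.Nat using (ℕ; zero; suc; _+_; _<_)
open import Data.Nat.Divisibility using (_∣_)
open import Data.Vec using (lookup)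
open import Data.Bool using (_∧_)
open import Data.Integer as ℤ using (ℤ; ∣_∣)
open import Data.Fin using (Fin; _≟_)
import Data.Fin
open import Data.Fin.Subset using (Subset; _∈_; _∉_; ⊤; ∁; ⁅_⁆; _∩_)
open import Data.Product using (Σ; ∃; _×_; _,_)
open import Relation.Nullary using (¬_; does)
open import Relation.Binary.PropositionalEquality using (_≡_)
open import Data.Bool using (Bool; true; false; if_then_else_)
open import Function.Bundles using (_⇔_)
open import Function.Definitions using (Injective)

-- A finite multigraph (parallel edges and loops allowed) with vertex set
-- Fin n and edge set Fin m; edge e joins tail e and head e (the orientation
-- is only a reference orientation, used for flows).
record Graph (n m : ℕ) : Set where
  field
    tail : Fin m → Fin n
    head : Fin m → Fin n
open Graph public

∑ℕ : ∀ {m} → (Fin m → ℕ) → ℕ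
∑ℕ {zero} f = 0
∑ℕ {suc m} f = f Data.Fin.zero + ∑ℕ (λ i → f (Data.Fin.suc i))

∑ℤ : ∀ {m} → (Fin m → ℤ) → ℤ
∑ℤ {zero} f = ℤ.0ℤ
∑ℤ {suc m} f = f Data.Fin.zero ℤ.+ ∑ℤ (λ i → f (Data.Fin.suc i))

ind : Bool → ℕ
ind true = 1
ind false = 0

mem : ∀ {m} → Fin m → Subset m → Bool
mem e S = lookup S e

-- degree of v in the spanning subgraph with edge set S (loops count twice)
degree : ∀ {n m} → Graph n m → Subset m → Fin n → ℕ
degree G S v = ∑ℕ (λ e → ind (mem e S ∧ does (tail G e ≟ v))
                      + ind (mem e S ∧ does (head G e ≟ v)))

-- A cycle: edge set in which every vertex has even degree
IsCycle : ∀ {n m} → Graph n m → Subset m → Set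
IsCycle G S = ∀ v → 2 ∣ degree G S v

data Reach {n m} (G : Graph n m) (S : Subset m) (u : Fin n) : Fin n → Set where
  here : Reach G S u u
  fwd  : ∀ {e} → Reach G S u (tail G e) → e ∈ S → Reach G S u (head G e)
  bwd  : ∀ {e} → Reach G S u (head G e) → e ∈ S → Reach G S u (tail G e)

ConnectedWith : ∀ {n m} → Graph n m → Subset m → Set
ConnectedWith G S = ∀ u v → Reach G S u v

Connected : ∀ {n m} → Graph n m → Set
Connected G = ConnectedWith G ⊤

TwoEdgeConnected : ∀ {n m} → Graph n m → Set
TwoEdgeConnected {m = m} G = Connected G × (∀ (e : Fin m) → ConnectedWith G (∁ ⁅ e ⁆))

NonSeparating : ∀ {n m} → Graph n m → Subset m → Set
NonSeparating G C = ConnectedWith G (∁ C)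

-- H (with vertex map π and edge map ι) is the contraction G/E(C):
-- vertices of H are the components of (V(G), E(C)) via π; edges of H are
-- exactly the edges of G not in C (ι is a bijection onto E(G) \ E(C)),
-- with endpoints mapped by π.
record IsContraction {n m n' m'} (G : Graph n m) (C : Subset m)
                     (H : Graph n' m') : Set where
  field
    π      : Fin n → Fin n'
    π-surj : ∀ x → ∃ λ v → π v ≡ x
    π-ker  : ∀ u v → (π u ≡ π v) ⇔ Reach G C u v
    ι      : Fin m' → Fin m
    ι-inj  : Injective _≡_ _≡_ ι
    ι-notC : ∀ i → ι i ∉ C
    ι-onto : ∀ e → e ∉ C → ∃ λ i → ι i ≡ e
    ι-tail : ∀ i → tail H i ≡ π (tail G (ι i))
    ι-head : ∀ i → head H i ≡ π (head G (ι i))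

outflow : ∀ {n m} → Graph n m → (Fin m → ℤ) → Fin n → ℤ
outflow G f v = ∑ℤ (λ e → (if does (tail G e ≟ v) then f e else ℤ.0ℤ)
                     ℤ.- (if does (head G e ≟ v) then f e else ℤ.0ℤ))

IsNZFlow : ∀ {n m} → ℕ → Graph n m → (Fin m → ℤ) → Set
IsNZFlow k G f = (∀ e → 0 < ∣ f e ∣ × ∣ f e ∣ < k)
               × (∀ v → outflow G f v ≡ ℤ.0ℤ)

HasNZFlow : ∀ {n m} → ℕ → Graph n m → Set
HasNZFlow {m = m} k G = ∃ λ (f : Fin m → ℤ) → IsNZFlow k G f

ContractionHasNZFlow : ∀ {n m} → ℕ → Graph n m → Subset m → Set
ContractionHasNZFlow k G C =
  Σ ℕ λ n' → Σ ℕ λ m' → Σ (Graph n' m') λ H → IsContraction G C H × HasNZFlow k H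

IsCDC : ∀ {n m} k → Graph n m → (Fin k → Subset m) → Set
IsCDC k G 𝒮 = (∀ i → IsCycle G (𝒮 i))
            × (∀ e → ∑ℕ (λ i → ind (mem e (𝒮 i))) ≡ 2)

-- Work over ℤ₂. A nowhere-zero 4-flow f on H = G/E(C) gives two even subgraphs of H covering
-- E(H): the edges where f is odd, and the edges with |f| = 2 completed to an even subgraph by a
-- T-join avoiding them; such a completion exists because every edge cut meets the |f| = 2 edges
-- evenly (the net flow ±2 across a cut vanishes). Both lift to even subgraphs P, Q of G by T-joins
-- inside C, and since G − E(C) is connected there is an even S agreeing with P ∩ Q on C. Then
-- S, S + P, S + Q, C + S + P + Q and C cover every edge exactly twice. All T-joins come from the
-- parity criterion: an edge set inside S with boundary t exists iff every union of components of
-- (V, S) contains an even number of vertices of t.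
module Submission where

open import Algebra.Bundles using (CommutativeRing)
open import Data.Bool as Bool using (Bool; true; false; not; _∧_; _∨_; _xor_; if_then_else_)
open import Data.Bool.Properties as BoolP using (xor-∧-commutativeRing)
open import Data.Fin using (Fin; zero; suc; _≟_)
open import Data.Fin.Patterns using (0F; 1F; 2F; 3F; 4F)
open import Data.Integer as ℤ using (ℤ; +_; -[1+_]; _⊖_; ∣_∣; 0ℤ; 1ℤ; -1ℤ)
import Data.Integer.Properties as ℤP
open import Data.Fin.Subset using (Subset; ∁)
open import Data.Fin.Subset.Properties using (anySubset?)
open import Data.Fin.Properties using (all?)
open import Data.Nat as ℕ using (ℕ)
open import Data.Nat.Divisibility using (_∣_; divides)
open import Data.Product using (∃; ∃₂; _×_; _,_; proj₁; proj₂)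
open import Data.Sum using (_⊎_; inj₁; inj₂)
open import Data.Vec using (lookup; tabulate; zipWith)
open import Data.Vec.Functional using ([]; _∷_)
import Data.Vec.Properties as VecP
open import Function using (_∘_; _⇔_; mk⇔; Equivalence)
open import Function.Definitions using (Injective)
open import Relation.Binary.PropositionalEquality
  using (_≡_; _≢_; refl; sym; trans; cong; cong₂; module ≡-Reasoning)
open import Relation.Nullary using (Dec; does; yes; no; _→-dec_; _×-dec_; contradiction)
open import Relation.Nullary.Decidable using (dec-false)
open import Defs

-- Used over ℤ₂ = (Bool, xor, ∧), where ∂ z v is the parity of the degree of v in z and
-- coboundary K e tells whether e crosses K, and over ℤ, where ∂ f is the net outflow of f.
module Boundary {c ℓ} (R : CommutativeRing c ℓ) where
  open CommutativeRing R hiding (zero; refl; sym; trans)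
  open import Algebra.Properties.Ring ring using (-‿distribˡ-*; -‿distribʳ-*)
  open import Algebra.Properties.Semiring.Sum semiring
  open import Relation.Binary.Reasoning.Setoid setoid

  δ : ∀ {n} → Fin n → Fin n → Carrier
  δ a v = if does (a ≟ v) then 1# else 0#

  ∂ : ∀ {n m} → Graph n m → (Fin m → Carrier) → Fin n → Carrier
  ∂ {m = m} G f v = ∑[ e < m ] ((δ (tail G e) v - δ (head G e) v) * f e)

  coboundary : ∀ {n m} → Graph n m → (Fin n → Carrier) → Fin m → Carrier
  coboundary G κ e = κ (tail G e) - κ (head G e)

  ∑-δ : ∀ {n} (κ : Fin n → Carrier) a → ∑[ v < n ] (κ v * δ a v) ≈ κ a
  ∑-δ {ℕ.suc n} κ zero = begin
    κ zero * 1# + ∑[ v < n ] (κ (suc v) * 0#)  ≈⟨ +-cong (*-identityʳ _) (sum-cong-≋ {n} (λ v → zeroʳ _)) ⟩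
    κ zero + ∑[ v < n ] 0#                     ≈⟨ +-congˡ (sum-replicate-zero n) ⟩
    κ zero + 0#                                ≈⟨ +-identityʳ _ ⟩
    κ zero                                     ∎
  ∑-δ {ℕ.suc n} κ (suc a) = begin
    κ zero * 0# + ∑[ v < n ] (κ (suc v) * δ a v)  ≈⟨ +-cong (zeroʳ _) (∑-δ (κ ∘ suc) a) ⟩
    0# + κ (suc a)                                ≈⟨ +-identityˡ _ ⟩
    κ (suc a)                                     ∎

  ∂-coboundary-duality : ∀ {n m} (G : Graph n m) κ f →
                         ∑[ v < n ] (κ v * ∂ G f v) ≈ ∑[ e < m ] (coboundary G κ e * f e)
  ∂-coboundary-duality {n} {m} G κ f = begin
    ∑[ v < n ] (κ v * ∂ G f v)
      ≈⟨ sum-cong-≋ {n} (λ v → *-distribˡ-sum (κ v) (λ e → d e v * f e)) ⟩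
    ∑[ v < n ] ∑[ e < m ] (κ v * (d e v * f e))
      ≈⟨ ∑-comm (λ v e → κ v * (d e v * f e)) ⟩
    ∑[ e < m ] ∑[ v < n ] (κ v * (d e v * f e))
      ≈⟨ sum-cong-≋ {m} (λ e → sum-cong-≋ {n} (λ v → *-assoc _ _ _)) ⟨
    ∑[ e < m ] ∑[ v < n ] (κ v * d e v * f e)
      ≈⟨ sum-cong-≋ {m} (λ e → *-distribʳ-sum (f e) (λ v → κ v * d e v)) ⟨
    ∑[ e < m ] (∑[ v < n ] (κ v * d e v) * f e)
      ≈⟨ sum-cong-≋ {m} (λ e → *-congʳ (∑-δ-difference e)) ⟩
    ∑[ e < m ] (coboundary G κ e * f e)
      ∎
    where
    d : Fin m → Fin n → Carrier
    d e v = δ (tail G e) v - δ (head G e) v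
    distrib-difference : ∀ x a b → x * (a - b) ≈ x * a + - x * b
    distrib-difference x a b = begin
      x * (a - b)        ≈⟨ distribˡ x a (- b) ⟩
      x * a + x * - b    ≈⟨ +-congˡ (-‿distribʳ-* x b) ⟨
      x * a + - (x * b)  ≈⟨ +-congˡ (-‿distribˡ-* x b) ⟩
      x * a + - x * b    ∎
    ∑-δ-difference : ∀ e → ∑[ v < n ] (κ v * d e v) ≈ coboundary G κ e
    ∑-δ-difference e = begin
      ∑[ v < n ] (κ v * d e v)
        ≈⟨ sum-cong-≋ {n} (λ v → distrib-difference (κ v) _ _) ⟩
      ∑[ v < n ] (κ v * δ (tail G e) v + - κ v * δ (head G e) v)
        ≈⟨ ∑-distrib-+ (λ v → κ v * δ (tail G e) v) (λ v → - κ v * δ (head G e) v) ⟩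
      ∑[ v < n ] (κ v * δ (tail G e) v) + ∑[ v < n ] (- κ v * δ (head G e) v)
        ≈⟨ +-cong (∑-δ κ (tail G e)) (∑-δ (-_ ∘ κ) (head G e)) ⟩
      coboundary G κ e
        ∎

open Boundary xor-∧-commutativeRing
open import Algebra.Properties.Semiring.Sum (CommutativeRing.semiring xor-∧-commutativeRing)
  using (sum; sum-syntax; sum-cong-≗; sum-replicate-zero; ∑-distrib-+; ∑-comm; *-distribˡ-sum)
open import Algebra.Properties.CommutativeSemigroup
  (CommutativeRing.*-commutativeSemigroup xor-∧-commutativeRing) using (x∙yz≈y∙xz)

_⊕_ : ∀ {A : Set} → (A → Bool) → (A → Bool) → A → Bool
(z ⊕ w) x = z x xor w x

≢⇒xor≡true : ∀ {x y} → x ≢ y → x xor y ≡ true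
≢⇒xor≡true {x} {y} x≢y = trans (cong (_xor y) (BoolP.¬-not x≢y)) (BoolP.xor-inverseˡ y)

≢-xor-≢ : ∀ {x y u v} → x ≢ y → u ≢ v → x xor u ≡ y xor v
≢-xor-≢ {y = y} {v = v} x≢y u≢v =
  trans (cong₂ _xor_ (BoolP.¬-not x≢y) (BoolP.¬-not u≢v)) (BoolP.xor-annihilates-not y v)

≡⇒xor≡false : ∀ {x y} → x ≡ y → x xor y ≡ false
≡⇒xor≡false {y = y} refl = BoolP.xor-same y

xor-cancelʳ : ∀ x y → (x xor y) xor y ≡ x
xor-cancelʳ x y =
  trans (BoolP.xor-assoc x y y) (trans (cong (x xor_) (BoolP.xor-same y)) (BoolP.xor-identityʳ x))

xor-cancelˡ : ∀ x y → x xor (y xor x) ≡ y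
xor-cancelˡ x y =
  trans (cong (x xor_) (BoolP.xor-comm y x)) (trans (sym (BoolP.xor-assoc x x y)) (cong (_xor y) (BoolP.xor-same x)))

Even : ∀ {n m} → Graph n m → (Fin m → Bool) → Set
Even G z = ∀ v → ∂ G z v ≡ false

∂-⊕ : ∀ {n m} (G : Graph n m) z w v → ∂ G (z ⊕ w) v ≡ ∂ G z v xor ∂ G w v
∂-⊕ {m = m} G z w v = begin
  ∑[ e < m ] (d e ∧ (z e xor w e))          ≡⟨ sum-cong-≗ {m} (λ e → BoolP.∧-distribˡ-xor (d e) (z e) (w e)) ⟩
  ∑[ e < m ] ((d e ∧ z e) xor (d e ∧ w e))  ≡⟨ ∑-distrib-+ (λ e → d e ∧ z e) (λ e → d e ∧ w e) ⟩
  ∂ G z v xor ∂ G w v                       ∎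
  where
  open ≡-Reasoning
  d : Fin m → Bool
  d e = δ (tail G e) v xor δ (head G e) v

even-⊕ : ∀ {n m} (G : Graph n m) {z w} → Even G z → Even G w → Even G (z ⊕ w)
even-⊕ G {z} {w} z-even w-even v = trans (∂-⊕ G z w v) (cong₂ _xor_ (z-even v) (w-even v))

odd : ℕ → Bool
odd ℕ.zero = false
odd (ℕ.suc n) = not (odd n)

odd-+ : ∀ a b → odd (a ℕ.+ b) ≡ odd a xor odd b
odd-+ ℕ.zero b = refl
odd-+ (ℕ.suc a) b = trans (cong not (odd-+ a b)) (BoolP.not-distribˡ-xor (odd a) (odd b))

odd-∑ℕ : ∀ {m} (g : Fin m → ℕ) → odd (∑ℕ g) ≡ ∑[ e < m ] odd (g e)
odd-∑ℕ {ℕ.zero} g = refl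
odd-∑ℕ {ℕ.suc m} g = trans (odd-+ (g zero) _) (cong (odd (g zero) xor_) (odd-∑ℕ (g ∘ suc)))

2∣⇔¬odd : ∀ {n} → 2 ∣ n ⇔ odd n ≡ false
2∣⇔¬odd = mk⇔ 2∣⇒¬odd ¬odd⇒2∣
  where
  odd-double : ∀ q → odd (q ℕ.* 2) ≡ false
  odd-double ℕ.zero = refl
  odd-double (ℕ.suc q) = trans (BoolP.not-involutive _) (odd-double q)
  2∣⇒¬odd : ∀ {n} → 2 ∣ n → odd n ≡ false
  2∣⇒¬odd (divides q refl) = odd-double q
  ¬odd⇒2∣ : ∀ {n} → odd n ≡ false → 2 ∣ n
  ¬odd⇒2∣ {ℕ.zero} _ = divides 0 refl
  ¬odd⇒2∣ {ℕ.suc (ℕ.suc n)} eq with ¬odd⇒2∣ {n} (trans (sym (BoolP.not-involutive (odd n))) eq)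
  ... | divides q refl = divides (ℕ.suc q) refl

odd-degree : ∀ {n m} (G : Graph n m) S v → odd (degree G S v) ≡ ∂ G (lookup S) v
odd-degree {m = m} G S v =
  trans (odd-∑ℕ (λ e → ind (mem e S ∧ does (tail G e ≟ v)) ℕ.+ ind (mem e S ∧ does (head G e ≟ v))))
        (sum-cong-≗ {m} (λ e → incidence (lookup S e) (does (tail G e ≟ v)) (does (head G e ≟ v))))
  where
  incidence : ∀ s a b → odd (ind (s ∧ a) ℕ.+ ind (s ∧ b))
                      ≡ ((if a then true else false) xor (if b then true else false)) ∧ s
  incidence false a b = sym (BoolP.∧-zeroʳ _)
  incidence true true true = refl
  incidence true true false = refl
  incidence true false true = refl
  incidence true false false = refl

isCycle⇔even : ∀ {n m} (G : Graph n m) S → IsCycle G S ⇔ Even G (lookup S)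
isCycle⇔even G S = mk⇔
  (λ cycle v → trans (sym (odd-degree G S v)) (Equivalence.to 2∣⇔¬odd (cycle v)))
  (λ even v → Equivalence.from 2∣⇔¬odd (trans (odd-degree G S v) (even v)))

even⇒isCycle : ∀ {n m} (G : Graph n m) {z} → Even G z → IsCycle G (tabulate z)
even⇒isCycle {m = m} G {z} z-even = Equivalence.from (isCycle⇔even G (tabulate z)) λ v →
  trans (sum-cong-≗ {m} λ e → cong (_ ∧_) (VecP.lookup∘tabulate z e)) (z-even v)

_⊆_ : ∀ {m} → (Fin m → Bool) → (Fin m → Bool) → Set
z ⊆ S = ∀ e → z e ≡ true → S e ≡ true

∷-⊆ : ∀ {m} {b} {z : Fin m → Bool} {S} → (b ≡ true → S zero ≡ true) → z ⊆ (S ∘ suc) → (b ∷ z) ⊆ S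
∷-⊆ b⊆S₀ z⊆S zero = b⊆S₀
∷-⊆ b⊆S₀ z⊆S (suc e) = z⊆S e

-- K is a union of components of the spanning subgraph (V, S).
Closed : ∀ {n m} → Graph n m → (Fin m → Bool) → Subset n → Set
Closed G S K = ∀ e → S e ≡ true → lookup K (tail G e) ≡ lookup K (head G e)

closed? : ∀ {n m} (G : Graph n m) S K → Dec (Closed G S K)
closed? G S K = all? (λ e → (S e Bool.≟ true) →-dec (lookup K (tail G e) Bool.≟ lookup K (head G e)))

closed-xor : ∀ {n m} (G : Graph n m) {S K K₀} → Closed G S K → Closed G S K₀ → Closed G S (zipWith _xor_ K K₀)
closed-xor G {K = K} {K₀} c c₀ e s = begin
  lookup (zipWith _xor_ K K₀) (tail G e)            ≡⟨ VecP.lookup-zipWith _xor_ (tail G e) K K₀ ⟩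
  lookup K (tail G e) xor lookup K₀ (tail G e)      ≡⟨ cong₂ _xor_ (c e s) (c₀ e s) ⟩
  lookup K (head G e) xor lookup K₀ (head G e)      ≡⟨ VecP.lookup-zipWith _xor_ (head G e) K K₀ ⟨
  lookup (zipWith _xor_ K K₀) (head G e)            ∎
  where open ≡-Reasoning

dropEdge : ∀ {n m} → Graph n (ℕ.suc m) → Graph n m
dropEdge G = record { tail = tail G ∘ suc ; head = head G ∘ suc }

closed-∷ : ∀ {n m} (G : Graph n (ℕ.suc m)) {S K} → Closed (dropEdge G) (S ∘ suc) K →
           (S zero ≡ true → lookup K (tail G zero) ≡ lookup K (head G zero)) → Closed G S K
closed-∷ G c c₀ zero = c₀
closed-∷ G c c₀ (suc e) = c e

_·_ : ∀ {n} → Subset n → (Fin n → Bool) → Bool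
_·_ {n} K t = ∑[ v < n ] (lookup K v ∧ t v)

·-⊕ : ∀ {n} (K : Subset n) t u → K · (t ⊕ u) ≡ K · t xor K · u
·-⊕ {n} K t u = trans (sum-cong-≗ {n} (λ v → BoolP.∧-distribˡ-xor (lookup K v) (t v) (u v)))
                      (∑-distrib-+ (λ v → lookup K v ∧ t v) (λ v → lookup K v ∧ u v))

zipWith-· : ∀ {n} (K K₀ : Subset n) t → zipWith _xor_ K K₀ · t ≡ K · t xor K₀ · t
zipWith-· {n} K K₀ t =
  trans (sum-cong-≗ {n} (λ v → trans (cong (_∧ t v) (VecP.lookup-zipWith _xor_ v K K₀))
                                     (BoolP.∧-distribʳ-xor (t v) (lookup K v) (lookup K₀ v))))
        (∑-distrib-+ (λ v → lookup K v ∧ t v) (λ v → lookup K₀ v ∧ t v))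

∂-edge : ∀ {n m} → Graph n (ℕ.suc m) → Fin n → Bool
∂-edge G = δ (tail G zero) ⊕ δ (head G zero)

·-∂-edge : ∀ {n m} (G : Graph n (ℕ.suc m)) K t →
           K · (t ⊕ ∂-edge G) ≡ K · t xor (lookup K (tail G zero) xor lookup K (head G zero))
·-∂-edge G K t = trans (·-⊕ K t (∂-edge G))
  (cong (K · t xor_) (trans (·-⊕ K (δ (tail G zero)) (δ (head G zero)))
                            (cong₂ _xor_ (∑-δ (lookup K) (tail G zero)) (∑-δ (lookup K) (head G zero)))))

EvenOnComponents : ∀ {n m} → Graph n m → (Fin m → Bool) → (Fin n → Bool) → Set
EvenOnComponents G S t = ∀ K → Closed G S K → K · t ≡ false

-- An odd component K₀ of (V, S − e₀) separates the ends of e₀; then K + K₀ is closed under S for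
-- every K separating them, so all such K are odd as well, and adding e₀ to the join restores parity.
evenOnComponents-dropEdge : ∀ {n m} (G : Graph n (ℕ.suc m)) {S t} → EvenOnComponents G S t →
  ∀ K₀ → Closed (dropEdge G) (S ∘ suc) K₀ → K₀ · t ≡ true →
  EvenOnComponents (dropEdge G) (S ∘ suc) (t ⊕ ∂-edge G)
evenOnComponents-dropEdge G {S} {t} balanced K₀ c₀ odd₀ K c
  with lookup K (tail G zero) Bool.≟ lookup K (head G zero)
... | yes K-joins = trans (·-∂-edge G K t)
  (cong₂ _xor_ (balanced K (closed-∷ G {K = K} c (λ _ → K-joins))) (≡⇒xor≡false K-joins))
... | no K-splits = trans (·-∂-edge G K t) (cong₂ _xor_ K-odd (≢⇒xor≡true K-splits))
  where
  open ≡-Reasoning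
  K₀-splits : lookup K₀ (tail G zero) ≢ lookup K₀ (head G zero)
  K₀-splits K₀-joins with () ← trans (sym (balanced K₀ (closed-∷ G {K = K₀} c₀ (λ _ → K₀-joins)))) odd₀
  K⊕K₀-closed : Closed G S (zipWith _xor_ K K₀)
  K⊕K₀-closed = closed-∷ G {K = zipWith _xor_ K K₀} (closed-xor (dropEdge G) {K = K} {K₀} c c₀)
    λ _ → begin
      lookup (zipWith _xor_ K K₀) (tail G zero)           ≡⟨ VecP.lookup-zipWith _xor_ (tail G zero) K K₀ ⟩
      lookup K (tail G zero) xor lookup K₀ (tail G zero)  ≡⟨ ≢-xor-≢ K-splits K₀-splits ⟩
      lookup K (head G zero) xor lookup K₀ (head G zero)  ≡⟨ VecP.lookup-zipWith _xor_ (head G zero) K K₀ ⟨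
      lookup (zipWith _xor_ K K₀) (head G zero)           ∎
  K-odd : K · t ≡ true
  K-odd = begin
    K · t                              ≡⟨ xor-cancelʳ (K · t) (K₀ · t) ⟨
    (K · t xor K₀ · t) xor K₀ · t      ≡⟨ cong (_xor K₀ · t) (zipWith-· K K₀ t) ⟨
    zipWith _xor_ K K₀ · t xor K₀ · t  ≡⟨ cong₂ _xor_ (balanced (zipWith _xor_ K K₀) K⊕K₀-closed) odd₀ ⟩
    true                              ∎

TJoin : ∀ {n m} → Graph n m → (Fin m → Bool) → (Fin n → Bool) → Set
TJoin G S t = ∃ λ z → z ⊆ S × (∀ v → ∂ G z v ≡ t v)

tJoin-skip : ∀ {n m} (G : Graph n (ℕ.suc m)) {S t} → TJoin (dropEdge G) (S ∘ suc) t → TJoin G S t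
tJoin-skip G (z , z⊆S , ∂z) =
  (false ∷ z) , ∷-⊆ (λ ()) z⊆S , λ v →
  trans (cong (_xor ∂ (dropEdge G) z v) (BoolP.∧-zeroʳ (∂-edge G v))) (∂z v)

tJoin-take : ∀ {n m} (G : Graph n (ℕ.suc m)) {S t} → S zero ≡ true →
             TJoin (dropEdge G) (S ∘ suc) (t ⊕ ∂-edge G) → TJoin G S t
tJoin-take G {t = t} S₀ (z , z⊆S , ∂z) = (true ∷ z) , ∷-⊆ (λ _ → S₀) z⊆S , λ v →
  trans (cong₂ _xor_ (BoolP.∧-identityʳ (∂-edge G v)) (∂z v)) (xor-cancelˡ (∂-edge G v) (t v))

tJoin : ∀ {n m} (G : Graph n m) S t → EvenOnComponents G S t → TJoin G S t
tJoin {n} {ℕ.zero} G S t balanced = (λ ()) , (λ ()) , λ v → sym (t-vanishes v)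
  where
  t-vanishes : ∀ v → t v ≡ false
  t-vanishes v = begin
    t v                           ≡⟨ ∑-δ t v ⟨
    ∑[ w < n ] (t w ∧ δ v w)      ≡⟨ sum-cong-≗ {n} (λ w → trans (cong (_∧ t w) (VecP.lookup∘tabulate (δ v) w))
                                                             (BoolP.∧-comm (δ v w) (t w))) ⟨
    tabulate (δ v) · t            ≡⟨ balanced (tabulate (δ v)) (λ ()) ⟩
    false                         ∎
    where open ≡-Reasoning
tJoin {n} {ℕ.suc m} G S t balanced with S zero in S₀
... | false = tJoin-skip G (tJoin (dropEdge G) (S ∘ suc) t λ K c →
                balanced K (closed-∷ G {K = K} c (λ S₀≡true → contradiction (trans (sym S₀) S₀≡true) λ ())))
... | true with anySubset? (λ K → closed? (dropEdge G) (S ∘ suc) K ×-dec (K · t Bool.≟ true))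
...   | no no-odd-component = tJoin-skip G (tJoin (dropEdge G) (S ∘ suc) t λ K c →
                                BoolP.¬-not (λ K-odd → no-odd-component (K , c , K-odd)))
...   | yes (K₀ , c₀ , odd₀) = tJoin-take G S₀ (tJoin (dropEdge G) (S ∘ suc) (t ⊕ ∂-edge G)
                                  (evenOnComponents-dropEdge G balanced K₀ c₀ odd₀))

EvenlyCut : ∀ {n m} → Graph n m → (Fin m → Bool) → (Fin m → Bool) → Set
EvenlyCut {m = m} G S w = ∀ K → Closed G S K → ∑[ e < m ] (coboundary G (lookup K) e ∧ w e) ≡ false

evenCompletion : ∀ {n m} (G : Graph n m) S w → EvenlyCut G S w → ∃ λ z → z ⊆ S × Even G (w ⊕ z)
evenCompletion G S w cut
  with tJoin G S (∂ G w) (λ K c → trans (∂-coboundary-duality G (lookup K) w) (cut K c))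
... | z , z⊆S , ∂z≡∂w = z , z⊆S , λ v →
  trans (∂-⊕ G w z v) (trans (cong (∂ G w v xor_) (∂z≡∂w v)) (BoolP.xor-same (∂ G w v)))

closed-constant : ∀ {n m} (G : Graph n m) {S : Subset m} K → Closed G (lookup S) K →
                  ∀ {u v} → Reach G S u v → lookup K u ≡ lookup K v
closed-constant G K c here = refl
closed-constant G K c (fwd r e∈S) = trans (closed-constant G K c r) (c _ (VecP.[]=⇒lookup e∈S))
closed-constant G K c (bwd r e∈S) = trans (closed-constant G K c r) (sym (c _ (VecP.[]=⇒lookup e∈S)))

connected⇒evenlyCut : ∀ {n m} (G : Graph n m) {S : Subset m} → ConnectedWith G S →
                      ∀ w → EvenlyCut G (lookup S) w
connected⇒evenlyCut {m = m} G connected w K c =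
  trans (sum-cong-≗ {m} λ e → cong (_∧ w e) (uncut e)) (sum-replicate-zero m)
  where
  uncut : ∀ e → coboundary G (lookup K) e ≡ false
  uncut e = ≡⇒xor≡false (closed-constant G K c (connected (tail G e) (head G e)))

module ℤ-Boundary = Boundary ℤP.+-*-commutativeRing
import Algebra.Properties.Semiring.Sum (CommutativeRing.semiring ℤP.+-*-commutativeRing) as ℤΣ

oddᶻ : ℤ → Bool
oddᶻ (+ n) = odd n
oddᶻ -[1+ n ] = not (odd n)

oddᶻ-⊖ : ∀ a b → oddᶻ (a ⊖ b) ≡ odd a xor odd b
oddᶻ-⊖ ℕ.zero ℕ.zero = refl
oddᶻ-⊖ ℕ.zero (ℕ.suc b) = refl
oddᶻ-⊖ (ℕ.suc a) ℕ.zero = sym (BoolP.xor-identityʳ _)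
oddᶻ-⊖ (ℕ.suc a) (ℕ.suc b) = trans (cong oddᶻ (ℤP.[1+m]⊖[1+n]≡m⊖n a b))
                                   (trans (oddᶻ-⊖ a b) (sym (BoolP.xor-annihilates-not (odd a) (odd b))))

oddᶻ-+ : ∀ x y → oddᶻ (x ℤ.+ y) ≡ oddᶻ x xor oddᶻ y
oddᶻ-+ (+ a) (+ b) = odd-+ a b
oddᶻ-+ (+ a) -[1+ b ] = oddᶻ-⊖ a (ℕ.suc b)
oddᶻ-+ -[1+ a ] (+ b) = trans (oddᶻ-⊖ b (ℕ.suc a)) (BoolP.xor-comm (odd b) _)
oddᶻ-+ -[1+ a ] -[1+ b ] = trans (BoolP.not-involutive (odd (a ℕ.+ b)))
  (trans (odd-+ a b) (sym (BoolP.xor-annihilates-not (odd a) (odd b))))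

oddᶻ-neg : ∀ x → oddᶻ (ℤ.- x) ≡ oddᶻ x
oddᶻ-neg (+ ℕ.zero) = refl
oddᶻ-neg (+ ℕ.suc n) = refl
oddᶻ-neg -[1+ n ] = refl

oddᶻ-sum : ∀ {m} (g : Fin m → ℤ) → oddᶻ (ℤΣ.sum g) ≡ ∑[ e < m ] oddᶻ (g e)
oddᶻ-sum {ℕ.zero} g = refl
oddᶻ-sum {ℕ.suc m} g = trans (oddᶻ-+ (g zero) _) (cong (oddᶻ (g zero) xor_) (oddᶻ-sum (g ∘ suc)))

∑ℤ≡sum : ∀ {m} (g : Fin m → ℤ) → ∑ℤ g ≡ ℤΣ.sum g
∑ℤ≡sum {ℕ.zero} g = refl
∑ℤ≡sum {ℕ.suc m} g = cong (λ s → g zero ℤ.+ s) (∑ℤ≡sum (g ∘ suc))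

outflowTerm : ∀ {n m} → Graph n m → (Fin m → ℤ) → Fin n → Fin m → ℤ
outflowTerm G f v e = (if does (tail G e ≟ v) then f e else 0ℤ) ℤ.- (if does (head G e ≟ v) then f e else 0ℤ)

outflow≡∂ : ∀ {n m} (G : Graph n m) f v → outflow G f v ≡ ℤ-Boundary.∂ G f v
outflow≡∂ {m = m} G f v = trans (∑ℤ≡sum (outflowTerm G f v))
  (ℤΣ.sum-cong-≗ {m} λ e → incidence (does (tail G e ≟ v)) (does (head G e ≟ v)) (f e))
  where
  incidence : ∀ a b x → (if a then x else 0ℤ) ℤ.- (if b then x else 0ℤ)
                      ≡ ((if a then 1ℤ else 0ℤ) ℤ.- (if b then 1ℤ else 0ℤ)) ℤ.* x
  incidence true true x = ℤP.+-inverseʳ x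
  incidence true false x = trans (ℤP.+-identityʳ x) (sym (ℤP.*-identityˡ x))
  incidence false true x = trans (ℤP.+-identityˡ (ℤ.- x)) (sym (ℤP.-1*i≡-i x))
  incidence false false x = refl

oddPart-even : ∀ {n m} (G : Graph n m) {f} → (∀ v → outflow G f v ≡ 0ℤ) → Even G (oddᶻ ∘ f)
oddPart-even {m = m} G {f} conserved v = begin
  ∂ G (oddᶻ ∘ f) v                       ≡⟨ sum-cong-≗ {m} (λ e →
                                              incidence (does (tail G e ≟ v)) (does (head G e ≟ v)) (f e)) ⟨
  ∑[ e < m ] oddᶻ (outflowTerm G f v e)  ≡⟨ oddᶻ-sum (outflowTerm G f v) ⟨
  oddᶻ (ℤΣ.sum (outflowTerm G f v))      ≡⟨ cong oddᶻ (trans (sym (∑ℤ≡sum (outflowTerm G f v))) (conserved v)) ⟩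
  false                                  ∎
  where
  open ≡-Reasoning
  incidence : ∀ a b x → oddᶻ ((if a then x else 0ℤ) ℤ.- (if b then x else 0ℤ))
                      ≡ ((if a then true else false) xor (if b then true else false)) ∧ oddᶻ x
  incidence true true x = cong oddᶻ (ℤP.+-inverseʳ x)
  incidence true false x = cong oddᶻ (ℤP.+-identityʳ x)
  incidence false true x = trans (cong oddᶻ (ℤP.+-identityˡ (ℤ.- x))) (oddᶻ-neg x)
  incidence false false x = refl

netFlow-zero : ∀ {n m} (G : Graph n m) {f} → (∀ v → outflow G f v ≡ 0ℤ) →
               ∀ κ → ℤΣ.∑[ e < m ] (ℤ-Boundary.coboundary G κ e ℤ.* f e) ≡ 0ℤ
netFlow-zero {n} {m} G {f} conserved κ = begin
  ℤΣ.∑[ e < m ] (ℤ-Boundary.coboundary G κ e ℤ.* f e)  ≡⟨ ℤ-Boundary.∂-coboundary-duality G κ f ⟨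
  ℤΣ.∑[ v < n ] (κ v ℤ.* ℤ-Boundary.∂ G f v)            ≡⟨ ℤΣ.sum-cong-≗ {n} (λ v → cong (κ v ℤ.*_) (∂≡0 v)) ⟩
  ℤΣ.∑[ v < n ] (κ v ℤ.* 0ℤ)                           ≡⟨ ℤΣ.sum-cong-≗ {n} (ℤP.*-zeroʳ ∘ κ) ⟩
  ℤΣ.∑[ v < n ] 0ℤ                                     ≡⟨ ℤΣ.sum-replicate-zero n ⟩
  0ℤ                                                   ∎
  where
  open ≡-Reasoning
  ∂≡0 : ∀ v → ℤ-Boundary.∂ G f v ≡ 0ℤ
  ∂≡0 v = trans (sym (outflow≡∂ G f v)) (conserved v)

[_]ᶻ : Bool → ℤ
[ b ]ᶻ = if b then 1ℤ else 0ℤ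

∣x∣≡2 : ∀ x → ∣ x ∣ ≡ 2 → x ≡ + 2 ⊎ x ≡ -[1+ 1 ]
∣x∣≡2 (+ _) refl = inj₁ refl
∣x∣≡2 -[1+ _ ] refl = inj₂ refl

x+x≡0⇒x≡0 : ∀ x → x ℤ.+ x ≡ 0ℤ → x ≡ 0ℤ
x+x≡0⇒x≡0 (+ ℕ.zero) _ = refl

halfCutTerm : ∀ b b′ x → (b xor b′ ≡ true → ∣ x ∣ ≡ 2) →
              ∃ λ w → ([ b ]ᶻ ℤ.- [ b′ ]ᶻ) ℤ.* x ≡ w ℤ.+ w × oddᶻ w ≡ b xor b′
halfCutTerm true true x _ = 0ℤ , refl , refl
halfCutTerm false false x _ = 0ℤ , refl , refl
halfCutTerm true false x two with ∣x∣≡2 x (two refl)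
... | inj₁ refl = 1ℤ , refl , refl
... | inj₂ refl = -1ℤ , refl , refl
halfCutTerm false true x two with ∣x∣≡2 x (two refl)
... | inj₁ refl = -1ℤ , refl , refl
... | inj₂ refl = 1ℤ , refl , refl

-- Each crossing edge carries ±2, so half the (vanishing) net flow out of K is a sum of ±1's, one
-- per crossing edge.
twosCut-even : ∀ {n m} (G : Graph n m) {f} → (∀ v → outflow G f v ≡ 0ℤ) →
  ∀ K → (∀ e → coboundary G (lookup K) e ≡ true → ∣ f e ∣ ≡ 2) →
  ∑[ e < m ] coboundary G (lookup K) e ≡ false
twosCut-even {n} {m} G {f} conserved K crossings-two = begin
  ∑[ e < m ] coboundary G (lookup K) e  ≡⟨ sum-cong-≗ {m} (λ e → proj₂ (proj₂ (half e))) ⟨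
  ∑[ e < m ] oddᶻ (w e)          ≡⟨ oddᶻ-sum w ⟨
  oddᶻ (ℤΣ.sum w)                ≡⟨ cong oddᶻ (x+x≡0⇒x≡0 (ℤΣ.sum w) doubled) ⟩
  false                          ∎
  where
  open ≡-Reasoning
  κ : Fin n → ℤ
  κ v = [ lookup K v ]ᶻ
  half : ∀ e → ∃ λ w → ℤ-Boundary.coboundary G κ e ℤ.* f e ≡ w ℤ.+ w × oddᶻ w ≡ coboundary G (lookup K) e
  half e = halfCutTerm (lookup K (tail G e)) (lookup K (head G e)) (f e) (crossings-two e)
  w : Fin m → ℤ
  w e = proj₁ (half e)
  doubled : ℤΣ.sum w ℤ.+ ℤΣ.sum w ≡ 0ℤ
  doubled = begin
    ℤΣ.sum w ℤ.+ ℤΣ.sum w                                ≡⟨ ℤΣ.∑-distrib-+ w w ⟨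
    ℤΣ.∑[ e < m ] (w e ℤ.+ w e)                          ≡⟨ ℤΣ.sum-cong-≗ {m} (proj₁ ∘ proj₂ ∘ half) ⟨
    ℤΣ.∑[ e < m ] (ℤ-Boundary.coboundary G κ e ℤ.* f e)  ≡⟨ netFlow-zero G conserved κ ⟩
    0ℤ                                                   ∎

oddOrTwo : ∀ x → 0 ℕ.< ∣ x ∣ → ∣ x ∣ ℕ.< 4 → oddᶻ x ∨ does (∣ x ∣ ℕ.≟ 2) ≡ true
oddOrTwo (+ 1) _ _ = refl
oddOrTwo (+ 2) _ _ = refl
oddOrTwo (+ 3) _ _ = refl
oddOrTwo (+ ℕ.suc (ℕ.suc (ℕ.suc (ℕ.suc _)))) _ (ℕ.s≤s (ℕ.s≤s (ℕ.s≤s (ℕ.s≤s ()))))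
oddOrTwo -[1+ 0 ] _ _ = refl
oddOrTwo -[1+ 1 ] _ _ = refl
oddOrTwo -[1+ 2 ] _ _ = refl
oddOrTwo -[1+ ℕ.suc (ℕ.suc (ℕ.suc _)) ] _ (ℕ.s≤s (ℕ.s≤s (ℕ.s≤s (ℕ.s≤s ()))))

nz4Flow⇒evenCover : ∀ {n m} (H : Graph n m) {f} → IsNZFlow 4 H f →
                    ∃₂ λ (p q : Fin m → Bool) → Even H p × Even H q × (∀ e → p e ∨ q e ≡ true)
nz4Flow⇒evenCover {m = m} H {f} (nowhere-zero , conserved) =
  let R , R⊆¬two , two⊕R-even = evenCompletion H (not ∘ two) two twos-evenlyCut
  in oddᶻ ∘ f , two ⊕ R , oddPart-even H conserved , two⊕R-even , covers R R⊆¬two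
  where
  two : Fin m → Bool
  two e = does (∣ f e ∣ ℕ.≟ 2)
  twos-evenlyCut : EvenlyCut H (not ∘ two) two
  twos-evenlyCut K closed = trans (sum-cong-≗ {m} crossing-is-two) (twosCut-even H conserved K crossings-two)
    where
    uncrossed : ∀ e → two e ≡ false → coboundary H (lookup K) e ≡ false
    uncrossed e two-e = ≡⇒xor≡false (closed e (cong not two-e))
    crossing-is-two : ∀ e → coboundary H (lookup K) e ∧ two e ≡ coboundary H (lookup K) e
    crossing-is-two e with two e in two-e
    ... | true = BoolP.∧-identityʳ _
    ... | false = trans (BoolP.∧-zeroʳ _) (sym (uncrossed e two-e))
    crossings-two : ∀ e → coboundary H (lookup K) e ≡ true → ∣ f e ∣ ≡ 2
    crossings-two e crosses with ∣ f e ∣ ℕ.≟ 2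
    ... | yes ∣fe∣≡2 = ∣fe∣≡2
    ... | no ∣fe∣≢2 with () ← trans (sym (uncrossed e (dec-false (∣ f e ∣ ℕ.≟ 2) ∣fe∣≢2))) crosses
  covers : ∀ (R : Fin m → Bool) → R ⊆ (not ∘ two) → ∀ e → oddᶻ (f e) ∨ (two ⊕ R) e ≡ true
  covers R R⊆¬two e with two e in two-e | R e in R-e
  ... | true | false = BoolP.∨-zeroʳ (oddᶻ (f e))
  ... | true | true with () ← trans (sym (cong not two-e)) (R⊆¬two e R-e)
  ... | false | r = cong (_∨ r) (begin
    oddᶻ (f e)                 ≡⟨ BoolP.∨-identityʳ (oddᶻ (f e)) ⟨
    oddᶻ (f e) ∨ false         ≡⟨ cong (oddᶻ (f e) ∨_) two-e ⟨
    oddᶻ (f e) ∨ two e         ≡⟨ oddOrTwo (f e) (proj₁ (nowhere-zero e)) (proj₂ (nowhere-zero e)) ⟩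
    true                       ∎)
    where open ≡-Reasoning

push : ∀ {m m′} → (Fin m′ → Fin m) → (Fin m′ → Bool) → Fin m → Bool
push {m′ = m′} ι D e = ∑[ i < m′ ] (D i ∧ δ (ι i) e)

∑-push : ∀ {m m′} (ι : Fin m′ → Fin m) D g → ∑[ e < m ] (g e ∧ push ι D e) ≡ ∑[ i < m′ ] (D i ∧ g (ι i))
∑-push {m} {m′} ι D g = begin
  ∑[ e < m ] (g e ∧ push ι D e)
    ≡⟨ sum-cong-≗ {m} (λ e → *-distribˡ-sum (g e) (λ i → D i ∧ δ (ι i) e)) ⟩
  ∑[ e < m ] ∑[ i < m′ ] (g e ∧ (D i ∧ δ (ι i) e))
    ≡⟨ ∑-comm (λ e i → g e ∧ (D i ∧ δ (ι i) e)) ⟩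
  ∑[ i < m′ ] ∑[ e < m ] (g e ∧ (D i ∧ δ (ι i) e))
    ≡⟨ sum-cong-≗ {m′} (λ i → sum-cong-≗ {m} (λ e → x∙yz≈y∙xz (g e) (D i) _)) ⟩
  ∑[ i < m′ ] ∑[ e < m ] (D i ∧ (g e ∧ δ (ι i) e))
    ≡⟨ sum-cong-≗ {m′} (λ i → *-distribˡ-sum (D i) (λ e → g e ∧ δ (ι i) e)) ⟨
  ∑[ i < m′ ] (D i ∧ ∑[ e < m ] (g e ∧ δ (ι i) e))
    ≡⟨ sum-cong-≗ {m′} (λ i → cong (D i ∧_) (∑-δ g (ι i))) ⟩
  ∑[ i < m′ ] (D i ∧ g (ι i))
    ∎
  where open ≡-Reasoning

push-injective : ∀ {m m′} {ι : Fin m′ → Fin m} → Injective _≡_ _≡_ ι → ∀ D k → push ι D (ι k) ≡ D k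
push-injective {m′ = m′} {ι} ι-inj D k =
  trans (sum-cong-≗ {m′} λ i → cong (D i ∧_) (δ-injective i)) (∑-δ D k)
  where
  δ-injective : ∀ i → δ (ι i) (ι k) ≡ δ k i
  δ-injective i with ι i ≟ ι k | k ≟ i
  ... | yes _ | yes _ = refl
  ... | no _ | no _ = refl
  ... | yes ιi≡ιk | no k≢i = contradiction (sym (ι-inj ιi≡ιk)) k≢i
  ... | no ιi≢ιk | yes refl = contradiction refl ιi≢ιk

module _ {n m n′ m′} {G : Graph n m} {C : Subset m} {H : Graph n′ m′} (contraction : IsContraction G C H) where
  open IsContraction contraction

  contractedSet : Subset n → Subset n′
  contractedSet K = tabulate (λ x → lookup K (proj₁ (π-surj x)))

  closed-factors : ∀ K → Closed G (lookup C) K → ∀ v → lookup K v ≡ lookup (contractedSet K) (π v)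
  closed-factors K closed v = begin
    lookup K v                          ≡⟨ closed-constant G K closed (Equivalence.to (π-ker v v′) (sym πv′≡πv)) ⟩
    lookup K v′                         ≡⟨ VecP.lookup∘tabulate (λ x → lookup K (proj₁ (π-surj x))) (π v) ⟨
    lookup (contractedSet K) (π v)      ∎
    where
    open ≡-Reasoning
    v′ : Fin n
    v′ = proj₁ (π-surj (π v))
    πv′≡πv : π v′ ≡ π v
    πv′≡πv = proj₂ (π-surj (π v))

  liftEven : ∀ {D} → Even H D → ∃ λ L → Even G L × (∀ i → L (ι i) ≡ D i)
  liftEven {D} D-even =
    let B , B⊆C , L-even = evenCompletion G (lookup C) (push ι D) push-evenlyCut
    in push ι D ⊕ B , L-even , lifts B B⊆C
    where
    lifts : ∀ (B : Fin m → Bool) → B ⊆ lookup C → ∀ i → (push ι D ⊕ B) (ι i) ≡ D i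
    lifts B B⊆C i = trans (cong₂ _xor_ (push-injective ι-inj D i) B-ιi≡false) (BoolP.xor-identityʳ (D i))
      where
      B-ιi≡false : B (ι i) ≡ false
      B-ιi≡false = BoolP.¬-not λ B-ιi → ι-notC i (VecP.lookup⇒[]= (ι i) C (B⊆C (ι i) B-ιi))
    push-evenlyCut : EvenlyCut G (lookup C) (push ι D)
    push-evenlyCut K closed = begin
      ∑[ e < m ] (coboundary G (lookup K) e ∧ push ι D e)
        ≡⟨ ∑-push ι D (coboundary G (lookup K)) ⟩
      ∑[ i < m′ ] (D i ∧ coboundary G (lookup K) (ι i))
        ≡⟨ sum-cong-≗ {m′} (λ i → trans (BoolP.∧-comm (D i) _) (cong (_∧ D i) (coboundary-ι i))) ⟩
      ∑[ i < m′ ] (coboundary H (lookup K′) i ∧ D i)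
        ≡⟨ ∂-coboundary-duality H (lookup K′) D ⟨
      K′ · ∂ H D
        ≡⟨ sum-cong-≗ {n′} (λ x → trans (cong (lookup K′ x ∧_) (D-even x)) (BoolP.∧-zeroʳ _)) ⟩
      ∑[ x < n′ ] false
        ≡⟨ sum-replicate-zero n′ ⟩
      false
        ∎
      where
      open ≡-Reasoning
      K′ : Subset n′
      K′ = contractedSet K
      lookup-K′ : ∀ v → lookup K v ≡ lookup K′ (π v)
      lookup-K′ = closed-factors K closed
      coboundary-ι : ∀ i → coboundary G (lookup K) (ι i) ≡ coboundary H (lookup K′) i
      coboundary-ι i = cong₂ _xor_
        (trans (lookup-K′ (tail G (ι i))) (cong (lookup K′) (sym (ι-tail i))))
        (trans (lookup-K′ (head G (ι i))) (cong (lookup K′) (sym (ι-head i))))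

  liftEvenCover : (∃₂ λ (p q : Fin m′ → Bool) → Even H p × Even H q × (∀ i → p i ∨ q i ≡ true)) →
                  ∃₂ λ (P Q : Fin m → Bool) →
                    Even G P × Even G Q × (∀ e → lookup C e ≡ false → P e ∨ Q e ≡ true)
  liftEvenCover (p , q , p-even , q-even , p∨q) =
    let P , P-even , P∘ι = liftEven p-even
        Q , Q-even , Q∘ι = liftEven q-even
    in P , Q , P-even , Q-even , covers P Q P∘ι Q∘ι
    where
    covers : ∀ (P Q : Fin m → Bool) → (∀ i → P (ι i) ≡ p i) → (∀ i → Q (ι i) ≡ q i) →
             ∀ e → lookup C e ≡ false → P e ∨ Q e ≡ true
    covers P Q P∘ι Q∘ι e e∉C with ι-onto e (λ e∈C → contradiction (trans (sym e∉C) (VecP.[]=⇒lookup e∈C)) λ ())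
    ... | i , refl = trans (cong₂ _∨_ (P∘ι i) (Q∘ι i)) (p∨q i)

evenExtension : ∀ {n m} (G : Graph n m) {C : Subset m} → NonSeparating G C →
                ∀ (w : Fin m → Bool) →
                ∃ λ (S : Fin m → Bool) → Even G S × (∀ e → lookup C e ≡ true → S e ≡ w e)
evenExtension {m = m} G {C} nonSeparating w =
  let T , T⊆¬C , S-even = evenCompletion G (lookup (∁ C)) w∣C (connected⇒evenlyCut G nonSeparating w∣C)
  in w∣C ⊕ T , S-even , agrees T T⊆¬C
  where
  w∣C : Fin m → Bool
  w∣C e = lookup C e ∧ w e
  agrees : ∀ (T : Fin m → Bool) → T ⊆ lookup (∁ C) → ∀ e → lookup C e ≡ true → (w∣C ⊕ T) e ≡ w e
  agrees T T⊆¬C e e∈C with T e in T-e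
  ... | false = trans (BoolP.xor-identityʳ (w∣C e)) (cong (_∧ w e) e∈C)
  ... | true with () ← trans (cong not (sym e∈C)) (trans (sym (VecP.lookup-map e not C)) (T⊆¬C e T-e))

cdcFamily : ∀ {m} → Subset m → (P Q S : Fin m → Bool) → Fin 5 → Subset m
cdcFamily C P Q S =
  tabulate S ∷ tabulate (S ⊕ P) ∷ tabulate (S ⊕ Q) ∷ tabulate (lookup C ⊕ (S ⊕ (P ⊕ Q))) ∷ C ∷ []

coverCount : ∀ c p q s → (c ≡ true → s ≡ p ∧ q) → (c ≡ false → p ∨ q ≡ true) →
  ind s ℕ.+ (ind (s xor p) ℕ.+ (ind (s xor q) ℕ.+ (ind (c xor (s xor (p xor q))) ℕ.+ (ind c ℕ.+ 0)))) ≡ 2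
coverCount true p q s on-C _ with on-C refl
coverCount true true true _ _ _ | refl = refl
coverCount true true false _ _ _ | refl = refl
coverCount true false true _ _ _ | refl = refl
coverCount true false false _ _ _ | refl = refl
coverCount false false false s _ off-C with () ← off-C refl
coverCount false true true true _ _ = refl
coverCount false true true false _ _ = refl
coverCount false true false true _ _ = refl
coverCount false true false false _ _ = refl
coverCount false false true true _ _ = refl
coverCount false false true false _ _ = refl

fiveCycleDoubleCover : ∀ {n m} (G : Graph n m) {C : Subset m} {P Q S} →
  IsCycle G C → Even G P → Even G Q → Even G S →
  (∀ e → lookup C e ≡ true → S e ≡ P e ∧ Q e) → (∀ e → lookup C e ≡ false → P e ∨ Q e ≡ true) →
  IsCDC 5 G (cdcFamily C P Q S)
fiveCycleDoubleCover G {C} {P} {Q} {S} C-cycle P-even Q-even S-even on-C off-C = cycles , covered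
  where
  C-even : Even G (lookup C)
  C-even = Equivalence.to (isCycle⇔even G C) C-cycle
  cycles : ∀ i → IsCycle G (cdcFamily C P Q S i)
  cycles 0F = even⇒isCycle G S-even
  cycles 1F = even⇒isCycle G (even-⊕ G S-even P-even)
  cycles 2F = even⇒isCycle G (even-⊕ G S-even Q-even)
  cycles 3F = even⇒isCycle G (even-⊕ G C-even (even-⊕ G S-even (even-⊕ G P-even Q-even)))
  cycles 4F = C-cycle
  covered : ∀ e → ∑ℕ (λ i → ind (mem e (cdcFamily C P Q S i))) ≡ 2
  covered e rewrite VecP.lookup∘tabulate S e | VecP.lookup∘tabulate (S ⊕ P) e
                  | VecP.lookup∘tabulate (S ⊕ Q) e | VecP.lookup∘tabulate (lookup C ⊕ (S ⊕ (P ⊕ Q))) e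
    = coverCount (lookup C e) (P e) (Q e) (S e) (on-C e) (off-C e)

theorem3p1 : ∀ {n m} (G : Graph n m) (C : Subset m) →
    TwoEdgeConnected G → IsCycle G C → NonSeparating G C →
    ContractionHasNZFlow 4 G C →
    ∃ λ (𝒮 : Fin 5 → Subset m) → IsCDC 5 G 𝒮 × (∃ λ i → 𝒮 i ≡ C)
theorem3p1 G C _ C-cycle nonSeparating (_ , _ , H , contraction , _ , flow) =
  let P , Q , P-even , Q-even , P∨Q = liftEvenCover contraction (nz4Flow⇒evenCover H flow)
      S , S-even , S≡P∧Q = evenExtension G nonSeparating (λ e → P e ∧ Q e)
  in cdcFamily C P Q S , fiveCycleDoubleCover G C-cycle P-even Q-even S-even S≡P∧Q P∨Q , 4F , refl
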